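{- Run Algorithm DECOMP on a binary tree $T^b$. For any $i\in[I]$, the component tree $T_i$ is a binary tree.
   Context: Algorithm DECOMP (input: binary tree $T^b$ with $n$ vertices, parameter $m$). A component is a set of vertices of $T^b$; contracting all components gives the component tree. Initially $C$ is the set of singleton components, $F=\emptyset$. While $|C|>14m$, do one iteration: set $S=\emptyset$; for each $c\in C\setminus F$: if $c$ is the root component, add it to $S$; else if $c$ has exactly two children components, add it to $S$; else if the parent component of $c$ is in $F$, add it to $S$; else if $c$ has exactly one child component, add it to $S$ independently with probability $1/2$. Then each $c\in C\setminus(F\cup S)$ is merged into its closest ancestor (in the component tree) that is in $S$. Finally every component in $C\setminus F$ with at least $n/m$ vertices of $T^b$ is added to $F$. $I$ is the number of iterations; $C_i$, $F_i$ are the values of $C$, $F$ at the start of iteration $i$; $S_i$ is $S$ at the end of iteration $i$; $T_i$ is the rooted tree obtained by contracting all components of $C_i$ ($T_1=T^b$). -}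

module Defs where

open import Data.Nat using (ℕ; _*_; _≤_; _<_)
open import Data.Fin using (Fin; _≟_)
open import Data.Fin.Properties using (any?)
open import Data.Bool using (Bool; true)
open import Data.Maybe using (Maybe; just)
open import Data.List using (length; filter; allFin)
open import Data.Product using (Σ; _×_; _,_)
open import Data.Sum using (_⊎_)
open import Data.Empty using (⊥)
open import Data.Unit using (⊤)
open import Relation.Nullary using (¬_)
open import Relation.Binary.PropositionalEquality using (_≡_; _≢_)
open import Relation.Binary.Construct.Closure.ReflexiveTransitive using (Star)
open import Relation.Binary.Construct.Closure.Transitive using (TransClosure)

-- A rooted tree on the node set {c | Node c} ⊆ Fin n, given by a
-- parent relation  Par c p  ("p is the parent of c")  and a root r,
-- in which every node has at most two children.
IsBinaryRootedTree : ∀ {n} (Node : Fin n → Set) (Par : Fin n → Fin n → Set) (r : Fin n) → Set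
IsBinaryRootedTree {n} Node Par r =
  Node r
  × (∀ c p → Par c p → Node c × Node p)
  × (∀ p → ¬ Par r p)
  × (∀ c → Node c → c ≢ r → Σ (Fin n) λ p → Par c p × (∀ q → Par c q → q ≡ p))
  × (∀ c → Node c → Star Par c r)
  × (∀ p c₁ c₂ c₃ → Par c₁ p → Par c₂ p → Par c₃ p → c₁ ≡ c₂ ⊎ c₁ ≡ c₃ ⊎ c₂ ≡ c₃)

IsBinaryTree : ∀ {n} (par : Fin n → Maybe (Fin n)) (rt : Fin n) → Set
IsBinaryTree par rt = IsBinaryRootedTree (λ _ → ⊤) (λ v u → par v ≡ just u) rt

-- A state is a labelling L : Fin n → Fin n (component of vertex v is the
-- fibre of L over L v; components are identified with their labels) and
-- a predicate F on labels (the set F of frozen components).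
module DECOMP {n : ℕ} (par : Fin n → Maybe (Fin n)) (rt : Fin n) (m : ℕ) where

  Labelling : Set
  Labelling = Fin n → Fin n

  Comp : Labelling → Fin n → Set
  Comp L c = Σ (Fin n) λ v → L v ≡ c

  numComps : Labelling → ℕ
  numComps L = length (filter (λ c → any? (λ v → L v ≟ c)) (allFin n))

  compSize : Labelling → Fin n → ℕ
  compSize L c = length (filter (λ v → L v ≟ c) (allFin n))

  ParentComp : Labelling → Fin n → Fin n → Set
  ParentComp L c p = c ≢ p × (Σ (Fin n) λ v → Σ (Fin n) λ u → L v ≡ c × par v ≡ just u × L u ≡ p)

  ChildComp : Labelling → Fin n → Fin n → Set
  ChildComp L p d = ParentComp L d p

  TwoChildren : Labelling → Fin n → Set
  TwoChildren L c = Σ (Fin n) λ d₁ → Σ (Fin n) λ d₂ → d₁ ≢ d₂ × ChildComp L c d₁ × ChildComp L c d₂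
                      × (∀ d → ChildComp L c d → d ≡ d₁ ⊎ d ≡ d₂)

  OneChild : Labelling → Fin n → Set
  OneChild L c = Σ (Fin n) λ d → ChildComp L c d × (∀ d' → ChildComp L c d' → d' ≡ d)

  -- membership in S, given the outcomes coin c of the fair coin flips
  InS : Labelling → (Fin n → Set) → (Fin n → Bool) → Fin n → Set
  InS L F coin c = Comp L c × ¬ F c ×
    (c ≡ L rt
     ⊎ TwoChildren L c
     ⊎ (Σ (Fin n) λ p → ParentComp L c p × F p)
     ⊎ (OneChild L c × coin c ≡ true))

  StrictAnc : Labelling → Fin n → Fin n → Set
  StrictAnc L a c = TransClosure (ParentComp L) c a

  AncOrSelf : Labelling → Fin n → Fin n → Set
  AncOrSelf L a c = Star (ParentComp L) c a

  MergeSpec : Labelling → (Fin n → Set) → (Fin n → Bool) → Labelling → Set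
  MergeSpec L F coin L' = ∀ v →
    ((F (L v) ⊎ InS L F coin (L v)) → L' v ≡ L v)
    × (¬ F (L v) → ¬ InS L F coin (L v) →
        Σ (Fin n) λ a → InS L F coin a × StrictAnc L a (L v)
          × (∀ b → InS L F coin b → StrictAnc L b (L v) → AncOrSelf L b a)
          × L' v ≡ a)

  NewF : Labelling → (Fin n → Set) → Fin n → Set
  NewF L' F c = F c ⊎ (Comp L' c × ¬ F c × n ≤ compSize L' c * m)

  data Reach : Labelling → (Fin n → Set) → Set₁ where
    start : Reach (λ v → v) (λ _ → ⊥)
    step  : ∀ {L F} → Reach L F → 14 * m < numComps L →
            (coin : Fin n → Bool) (L' : Labelling) → MergeSpec L F coin L' →
            Reach L' (NewF L' F)

  CompTreeBinary : Labelling → Set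
  CompTreeBinary L = IsBinaryRootedTree (Comp L) (ParentComp L) (L rt)

module Submission where

-- Invariant: every component is a connected set of vertices labelled by its
-- topmost vertex, and every component has at most two child components.
-- In one iteration a component outside F ∪ S has at most one child component
-- (two children would put it in S), and its parent is not in F (that would
-- put it in S as well). Hence every new child c of a component p sits at the
-- bottom of a chain of merged components hanging below an old child of p,
-- and this chain is determined by its top, so distinct new children of p
-- come from distinct old children of p.

open import Defs
open import Data.Nat using (ℕ; _*_; _≤_; _<_)
open import Data.Bool using (Bool)
open import Data.Fin using (Fin; _≟_)
open import Data.Maybe using (Maybe; just; nothing)
open import Data.Maybe.Properties using (just-injective)
open import Data.Product using (∃; _×_; _,_; proj₁; proj₂)
open import Data.Sum using (_⊎_; inj₁; inj₂)
open import Data.Empty using (⊥-elim)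
open import Data.Unit using (tt)
open import Function using (_∘_)
open import Relation.Nullary using (¬_; Dec; yes; no)
open import Relation.Nullary.Decidable using (decidable-stable; ¬¬-excluded-middle; _⊎-dec_)
open import Relation.Nullary.Negation using (Stable; negated-stable; contradiction)
open import Relation.Binary.PropositionalEquality using (_≡_; _≢_; refl; sym; trans; cong; subst)
open import Relation.Binary.Construct.Closure.ReflexiveTransitive using (Star; ε; _◅_; _◅◅_)
open import Relation.Binary.Construct.Closure.Transitive using (TransClosure; [_]; _∷_)

by-cases : {P G : Set} → Stable G → (P → G) → (¬ P → G) → G
by-cases stable if-P if-¬P =
  stable λ ¬G → ¬¬-excluded-middle λ
    { (yes p) → ¬G (if-P p)
    ; (no ¬p) → ¬G (if-¬P ¬p) }

module _ {A : Set} {R : A → A → Set} where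

  plus⇒star : ∀ {x y} → TransClosure R x y → Star R x y
  plus⇒star [ r ] = r ◅ ε
  plus⇒star (r ∷ t) = r ◅ plus⇒star t

  ◅-plus : ∀ {x y z} → R x y → Star R y z → TransClosure R x z
  ◅-plus r ε = [ r ]
  ◅-plus r (s ◅ ss) = r ∷ ◅-plus s ss

  star-plus : ∀ {x y z} → Star R x y → TransClosure R y z → TransClosure R x z
  star-plus ε t = t
  star-plus (r ◅ s) t = r ∷ star-plus s t

  plus-uncons : ∀ {x y} → TransClosure R x y → ∃ λ z → R x z × Star R z y
  plus-uncons [ r ] = _ , r , ε
  plus-uncons (r ∷ t) = _ , r , plus⇒star t

  star-≡-or-plus : ∀ {x y} → Star R x y → x ≡ y ⊎ TransClosure R x y
  star-≡-or-plus ε = inj₁ refl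
  star-≡-or-plus (r ◅ s) = inj₂ (◅-plus r s)

module RootedFunctional {A : Set} (R : A → A → Set) (root : A)
                        (root-orphan : ∀ y → ¬ R root y)
                        (functional : ∀ {x y z} → R x y → R x z → y ≡ z) where

  acyclic : ∀ {x} → Star R x root → ¬ TransClosure R x x
  acyclic ε t = root-orphan _ (proj₁ (proj₂ (plus-uncons t)))
  acyclic (r ◅ s) t with plus-uncons t
  ... | _ , r′ , s′ with functional r r′
  ...   | refl = acyclic s (star-plus s′ [ r ])

  antisym : ∀ {a b} → Star R a root → Star R a b → Star R b a → a ≡ b
  antisym _ ε _ = refl
  antisym reach (r ◅ s) t = ⊥-elim (acyclic reach (◅-plus r (s ◅◅ t)))

module ComponentTrees {n : ℕ} (par : Fin n → Maybe (Fin n)) (rt : Fin n) (m : ℕ)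
                      (T : IsBinaryTree par rt) where
  open DECOMP par rt m

  Par : Fin n → Fin n → Set
  Par v u = par v ≡ just u

  root-orphan : ∀ u → ¬ Par rt u
  root-orphan = proj₁ (proj₂ (proj₂ T))

  has-parent : ∀ v → v ≢ rt → ∃ λ u → Par v u × (∀ w → Par v w → w ≡ u)
  has-parent v = proj₁ (proj₂ (proj₂ (proj₂ T))) v tt

  reaches-root : ∀ v → Star Par v rt
  reaches-root v = proj₁ (proj₂ (proj₂ (proj₂ (proj₂ T)))) v tt

  par-at-most-two-children : ∀ p c₁ c₂ c₃ → Par c₁ p → Par c₂ p → Par c₃ p →
                             c₁ ≡ c₂ ⊎ c₁ ≡ c₃ ⊎ c₂ ≡ c₃
  par-at-most-two-children = proj₂ (proj₂ (proj₂ (proj₂ (proj₂ T))))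

  par-functional : ∀ {x y z} → Par x y → Par x z → y ≡ z
  par-functional p q = just-injective (trans (sym p) q)

  module ParTree = RootedFunctional Par rt root-orphan par-functional

  -- the label of a component is its topmost vertex
  HeadedAt : Labelling → Fin n → Set
  HeadedAt L v = L v ≡ v ⊎ ∃ λ u → Par v u × L u ≡ L v

  Headed : Labelling → Set
  Headed L = ∀ v → HeadedAt L v

  AtMostTwoChildren : Labelling → Set
  AtMostTwoChildren L = ∀ p c₁ c₂ c₃ → ParentComp L c₁ p → ParentComp L c₂ p → ParentComp L c₃ p →
                        c₁ ≡ c₂ ⊎ c₁ ≡ c₃ ⊎ c₂ ≡ c₃

  headed-at? : ∀ L v → Dec (HeadedAt L v)
  headed-at? L v with L v ≟ v | par v
  ... | yes e | _ = yes (inj₁ e)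
  ... | no ne | nothing = no λ { (inj₁ e) → ne e ; (inj₂ (_ , () , _)) }
  ... | no ne | just u with L u ≟ L v
  ...   | yes e = yes (inj₂ (u , refl , e))
  ...   | no ne′ = no λ
          { (inj₁ e) → ne e
          ; (inj₂ (u′ , pu′ , e)) → ne′ (subst (λ w → L w ≡ L v) (just-injective (sym pu′)) e) }

  module ContractedTree (L : Labelling) (headed : Headed L) where

    PC : Fin n → Fin n → Set
    PC = ParentComp L

    label-root : L rt ≡ rt
    label-root with headed rt
    ... | inj₁ e = e
    ... | inj₂ (u , pu , _) = ⊥-elim (root-orphan u pu)

    label-above : ∀ {v} → Star Par v rt → Star Par v (L v)
    label-above ε = subst (Star Par rt) (sym label-root) ε
    label-above {v} (p ◅ s) with headed v
    ... | inj₁ e = subst (Star Par v) (sym e) ε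
    ... | inj₂ (u , pu , e) with par-functional p pu
    ...   | refl = p ◅ subst (Star Par u) e (label-above s)

    label-idempotent : ∀ {v} → Star Par v rt → L (L v) ≡ L v
    label-idempotent ε = cong L label-root
    label-idempotent {v} (p ◅ s) with headed v
    ... | inj₁ e = cong L e
    ... | inj₂ (u , pu , e) with par-functional p pu
    ...   | refl = trans (cong L (sym e)) (trans (label-idempotent s) e)

    comp-label : ∀ {c} → Comp L c → L c ≡ c
    comp-label (v , refl) = label-idempotent (reaches-root v)

    parent-comp-via-head : ∀ {c q} → PC c q → ∃ λ u → Par c u × L u ≡ q
    parent-comp-via-head (c≢q , v , u , refl , pu , refl) with headed v
    ... | inj₁ e rewrite e = u , pu , refl
    ... | inj₂ (u′ , pu′ , e) = contradiction (trans (sym e) (cong L (par-functional pu′ pu))) c≢q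

    parent-comp-functional : ∀ {c q q′} → PC c q → PC c q′ → q ≡ q′
    parent-comp-functional e e′ with parent-comp-via-head e | parent-comp-via-head e′
    ... | u , pu , refl | u′ , pu′ , refl = cong L (par-functional pu pu′)

    root-comp-orphan : ∀ q → ¬ PC (L rt) q
    root-comp-orphan q e with parent-comp-via-head e
    ... | u , pu , _ = root-orphan u (subst (λ x → Par x u) label-root pu)

    child-comp : ∀ {c p} → PC c p → Comp L c
    child-comp (_ , v , _ , e , _ , _) = v , e

    parent-comp : ∀ {c p} → PC c p → Comp L p
    parent-comp (_ , _ , u , _ , _ , e) = u , e

    reaches-root-comp : ∀ {c} → Comp L c → Star PC c (L rt)
    reaches-root-comp (v , refl) = along (reaches-root v)
      where
        along : ∀ {x} → Star Par x rt → Star PC (L x) (L rt)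
        along ε = ε
        along {x} (_◅_ {j = y} p s) with L x ≟ L y
        ... | yes e = subst (λ z → Star PC z (L rt)) (sym e) (along s)
        ... | no ne = (ne , x , y , refl , p , refl) ◅ along s

    module CompTree = RootedFunctional PC (L rt) root-comp-orphan parent-comp-functional

    parent-comp-exists : ∀ {c} → Comp L c → c ≢ L rt → ∃ λ p → PC c p × (∀ q → PC c q → q ≡ p)
    parent-comp-exists {c} comp c≢root
      with has-parent c (λ c≡rt → c≢root (trans c≡rt (sym label-root)))
    ... | u , pu , _ = L u , edge , λ q e → parent-comp-functional e edge
      where
        c≢Lu : c ≢ L u
        c≢Lu c≡Lu = ParTree.acyclic (reaches-root c)
                      (◅-plus pu (subst (Star Par u) (sym c≡Lu) (label-above (reaches-root u))))
        edge : PC c (L u)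
        edge = c≢Lu , c , u , comp-label comp , pu , refl

    compTreeBinary : AtMostTwoChildren L → CompTreeBinary L
    compTreeBinary two =
      (rt , refl) , (λ _ _ e → child-comp e , parent-comp e) , root-comp-orphan ,
      (λ _ → parent-comp-exists) , (λ _ → reaches-root-comp) , two

  module Iteration (L : Labelling) (F : Fin n → Set) (coin : Fin n → Bool) (L′ : Labelling)
                   (headed : Headed L) (two : AtMostTwoChildren L) (merge : MergeSpec L F coin L′) where
    open ContractedTree L headed

    S : Fin n → Set
    S = InS L F coin

    Kept : Fin n → Set
    Kept c = F c ⊎ S c

    Merged : Fin n → Set
    Merged c = ¬ Kept c

    -- F and S need not be decidable, so this case split is classical.
    kept-or-merged : ∀ {G} c → Stable G → (Kept c → G) → (Merged c → G) → G
    kept-or-merged _ = by-cases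

    ClosestSAbove : Fin n → Fin n → Set
    ClosestSAbove c a = ∀ b → S b → StrictAnc L b c → AncOrSelf L b a

    IsMergeTarget : Fin n → Fin n → Set
    IsMergeTarget c a = S a × StrictAnc L a c × ClosestSAbove c a

    kept-label : ∀ v → Kept (L v) → L′ v ≡ L v
    kept-label v = proj₁ (merge v)

    merged-label : ∀ v → Merged (L v) → ∃ λ a → IsMergeTarget (L v) a × L′ v ≡ a
    merged-label v mv with proj₂ (merge v) (mv ∘ inj₁) (mv ∘ inj₂)
    ... | a , sa , above , closest , e = a , (sa , above , closest) , e

    merge-target-unique : ∀ {c a b} → IsMergeTarget c a → IsMergeTarget c b → a ≡ b
    merge-target-unique (sa , ta , ca) (sb , tb , cb) =
      CompTree.antisym (reaches-root-comp (proj₁ sa)) (ca _ sb tb) (cb _ sa ta)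

    strict-anc-via-parent : ∀ {c q b} → PC c q → StrictAnc L b c → AncOrSelf L b q
    strict-anc-via-parent e t with plus-uncons t
    ... | _ , e′ , s with parent-comp-functional e e′
    ...   | refl = s

    parent-in-S-is-target : ∀ {c q} → S q → PC c q → IsMergeTarget c q
    parent-in-S-is-target sq e = sq , [ e ] , λ _ _ t → strict-anc-via-parent e t

    merged-parent-target : ∀ {c q a} → Merged q → PC c q → IsMergeTarget q a → IsMergeTarget c a
    merged-parent-target {c} {a = a} mq e (sa , ta , ca) = sa , e ∷ ta , closest
      where
        closest : ClosestSAbove c a
        closest b sb t with star-≡-or-plus (strict-anc-via-parent e t)
        ... | inj₁ refl = ⊥-elim (mq (inj₂ sb))
        ... | inj₂ t′ = ca b sb t′

    frozen-parent-not-merged : ∀ {c q} → PC c q → F q → ¬ Merged c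
    frozen-parent-not-merged e f mc =
      mc (inj₂ (child-comp e , mc ∘ inj₁ , inj₂ (inj₂ (inj₁ (_ , e , f)))))

    merged-one-child : ∀ {w c c′} → Merged w → PC c w → PC c′ w → c ≡ c′
    merged-one-child {w} {c} {c′} mw e e′ with c ≟ c′
    ... | yes c≡c′ = c≡c′
    ... | no c≢c′ = ⊥-elim (mw (inj₂ (parent-comp e , mw ∘ inj₁ ,
                      inj₂ (inj₁ (c , c′ , c≢c′ , e , e′ , λ d ed → others (two w c c′ d e e′ ed))))))
      where
        others : ∀ {d} → c ≡ c′ ⊎ c ≡ d ⊎ c′ ≡ d → d ≡ c ⊎ d ≡ c′
        others (inj₁ c≡c′) = contradiction c≡c′ c≢c′
        others (inj₂ (inj₁ c≡d)) = inj₁ (sym c≡d)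
        others (inj₂ (inj₂ c′≡d)) = inj₂ (sym c′≡d)

    label-respects-comp : ∀ {x y} → L x ≡ L y → L′ x ≡ L′ y
    label-respects-comp {x} {y} e = kept-or-merged (L x) (decidable-stable (L′ x ≟ L′ y)) kept merged
      where
        kept : Kept (L x) → L′ x ≡ L′ y
        kept k = trans (kept-label x k) (trans e (sym (kept-label y (subst Kept e k))))
        merged : Merged (L x) → L′ x ≡ L′ y
        merged mx with merged-label x mx | merged-label y (subst Merged e mx)
        ... | _ , tx , ex | _ , ty , ey =
          trans ex (trans (merge-target-unique tx (subst (λ c → IsMergeTarget c _) (sym e) ty)) (sym ey))

    merged-follows-parent : ∀ {v u} → Merged (L v) → PC (L v) (L u) → L′ v ≡ L′ u
    merged-follows-parent {v} {u} mv e with merged-label v mv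
    ... | _ , tv , ev = kept-or-merged (L u) (decidable-stable (L′ v ≟ L′ u)) kept merged
      where
        kept : Kept (L u) → L′ v ≡ L′ u
        kept (inj₁ f) = ⊥-elim (frozen-parent-not-merged e f mv)
        kept (inj₂ s) =
          trans ev (trans (merge-target-unique tv (parent-in-S-is-target s e))
                          (sym (kept-label u (inj₂ s))))
        merged : Merged (L u) → L′ v ≡ L′ u
        merged mu with merged-label u mu
        ... | _ , tu , eu = trans ev (trans (merge-target-unique tv (merged-parent-target mu e tu)) (sym eu))

    headed-after : Headed L′
    headed-after v with headed v
    ... | inj₂ (u , pu , e) = inj₂ (u , pu , label-respects-comp e)
    ... | inj₁ e = kept-or-merged (L v) (decidable-stable (headed-at? L′ v)) kept merged
      where
        kept : Kept (L v) → HeadedAt L′ v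
        kept k = inj₁ (trans (kept-label v k) e)
        merged : Merged (L v) → HeadedAt L′ v
        merged mv with merged-label v mv
        ... | _ , (_ , above , _) , _ with plus-uncons above
        ... | _ , edge , _ with parent-comp-via-head edge
        ... | u , pu , refl = inj₂ (u , subst (λ w → Par w u) e pu , sym (merged-follows-parent mv edge))

    -- A descent from w through merged components to the kept component x;
    -- merged components have at most one child, so x is determined by w.
    data MergedChain : Fin n → Fin n → Set where
      kept-end : ∀ {x} → Kept x → MergedChain x x
      descend  : ∀ {w c x} → Merged w → PC c w → MergedChain c x → MergedChain w x

    merged-chain-unique : ∀ {w x y} → MergedChain w x → MergedChain w y → x ≡ y
    merged-chain-unique (kept-end _) (kept-end _) = refl
    merged-chain-unique (kept-end k) (descend mw _ _) = contradiction k mw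
    merged-chain-unique (descend mw _ _) (kept-end k) = contradiction k mw
    merged-chain-unique (descend mw e d) (descend _ e′ d′) with merged-one-child mw e e′
    ... | refl = merged-chain-unique d d′

    NewEdgeOrigin : Fin n → Fin n → Set
    NewEdgeOrigin c p = Kept c × ∃ λ q → PC c q × (q ≡ p ⊎ Merged q × IsMergeTarget q p)

    new-edge-origin : ∀ {c p} → ParentComp L′ c p → ¬ ¬ NewEdgeOrigin c p
    new-edge-origin {p = p} (c≢p , v , u , ev , pu , eu) with headed-after v | headed v
    ... | inj₂ (u′ , pu′ , e′) | _ =
          contradiction (trans (sym ev) (trans (sym e′)
                                           (trans (cong L′ (par-functional pu′ pu)) eu))) c≢p
    ... | inj₁ _ | inj₂ (u′ , pu′ , e) =
          contradiction (trans (sym ev) (trans (label-respects-comp (sym e))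
                                                 (trans (cong L′ (par-functional pu′ pu)) eu))) c≢p
    ... | inj₁ e′ | inj₁ e with trans (sym e′) ev
    ...   | refl = kept-or-merged (L v) negated-stable kept-v merged-v
      where
        merged-v : Merged (L v) → ¬ ¬ NewEdgeOrigin v p
        merged-v mv with merged-label v mv
        ... | _ , (_ , above , _) , ea =
              ⊥-elim (CompTree.acyclic (reaches-root-comp (v , refl))
                        (subst (TransClosure PC (L v)) (trans (sym ea) (trans e′ (sym e))) above))
        v≢Lu : v ≢ L u
        v≢Lu v≡Lu = c≢p (trans (sym ev) (trans (label-respects-comp (trans e v≡Lu)) eu))
        edge : PC v (L u)
        edge = v≢Lu , v , u , e , pu , refl
        kept-v : Kept (L v) → ¬ ¬ NewEdgeOrigin v p
        kept-v kv = kept-or-merged (L u) negated-stable kept-u merged-u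
          where
            kept-u : Kept (L u) → ¬ ¬ NewEdgeOrigin v p
            kept-u ku ¬o = ¬o (subst Kept e kv , L u , edge , inj₁ (trans (sym (kept-label u ku)) eu))
            merged-u : Merged (L u) → ¬ ¬ NewEdgeOrigin v p
            merged-u mu ¬o with merged-label u mu
            ... | _ , tu , refl =
                  ¬o (subst Kept e kv , L u , edge , inj₂ (mu , subst (IsMergeTarget (L u)) eu tu))

    OldChildAbove : Fin n → Fin n → Set
    OldChildAbove c p = ∃ λ w → PC w p × MergedChain w c

    climb : ∀ {q p x} → Merged q → S p → TransClosure PC q p → ClosestSAbove q p → MergedChain q x →
            OldChildAbove x p
    climb mq sp [ e ] _ chain = _ , e , chain
    climb mq sp (_∷_ {y = q′} e above) closest chain =
      climb mq′ sp above (λ b sb t → closest b sb (e ∷ t)) (descend mq′ e chain)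
      where
        mq′ : Merged q′
        mq′ (inj₁ f) = frozen-parent-not-merged e f mq
        mq′ (inj₂ s) =
          CompTree.acyclic (reaches-root-comp (proj₁ sp)) (star-plus (closest q′ s [ e ]) above)

    old-child-above : ∀ {c p} → NewEdgeOrigin c p → OldChildAbove c p
    old-child-above (k , _ , e , inj₁ refl) = _ , e , kept-end k
    old-child-above (k , _ , e , inj₂ (mq , sp , above , closest)) =
      climb mq sp above closest (descend mq e (kept-end k))

    two-after : AtMostTwoChildren L′
    two-after p c₁ c₂ c₃ e₁ e₂ e₃ =
      decidable-stable (c₁ ≟ c₂ ⊎-dec c₁ ≟ c₃ ⊎-dec c₂ ≟ c₃) λ distinct →
        new-edge-origin e₁ λ o₁ → new-edge-origin e₂ λ o₂ → new-edge-origin e₃ λ o₃ →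
        distinct (pigeonhole (old-child-above o₁) (old-child-above o₂) (old-child-above o₃))
      where
        pigeonhole : OldChildAbove c₁ p → OldChildAbove c₂ p → OldChildAbove c₃ p →
                     c₁ ≡ c₂ ⊎ c₁ ≡ c₃ ⊎ c₂ ≡ c₃
        pigeonhole (w₁ , f₁ , d₁) (w₂ , f₂ , d₂) (w₃ , f₃ , d₃) with two p w₁ w₂ w₃ f₁ f₂ f₃
        ... | inj₁ refl = inj₁ (merged-chain-unique d₁ d₂)
        ... | inj₂ (inj₁ refl) = inj₂ (inj₁ (merged-chain-unique d₁ d₃))
        ... | inj₂ (inj₂ refl) = inj₂ (inj₂ (merged-chain-unique d₂ d₃))

  reachable-invariant : ∀ {L F} → Reach L F → Headed L × AtMostTwoChildren L
  reachable-invariant start = (λ _ → inj₁ refl) , initial-two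
    where
      initial-two : AtMostTwoChildren (λ v → v)
      initial-two p c₁ c₂ c₃ (_ , _ , _ , refl , q₁ , refl) (_ , _ , _ , refl , q₂ , refl)
                             (_ , _ , _ , refl , q₃ , refl) =
        par-at-most-two-children p c₁ c₂ c₃ q₁ q₂ q₃
  reachable-invariant (step {L} {F} reach _ coin L′ merge) with reachable-invariant reach
  ... | headed , two =
    let open Iteration L F coin L′ headed two merge in headed-after , two-after

claim2 : ∀ {n} (par : Fin n → Maybe (Fin n)) (rt : Fin n) (m : ℕ) → 1 ≤ m →
    IsBinaryTree par rt →
    ∀ L F → DECOMP.Reach par rt m L F → 14 * m < DECOMP.numComps par rt m L →
    DECOMP.CompTreeBinary par rt m L
claim2 par rt m _ T L _ reach _ with ComponentTrees.reachable-invariant par rt m T reach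
... | headed , two = ComponentTrees.ContractedTree.compTreeBinary par rt m T L headed two
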